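{- Let $n$ be divisible by $3$, $r=n/3$, and let $(C,\overline C)$ be an equitable partition of $Q_n$ with quotient matrix $\begin{pmatrix}0&3r\\ r&2r\end{pmatrix}$ such that $C$ is semilinear (i.e. the affine span of $C$ over $\mathbb F_2$ has dimension less than $n$). Then there exist sets $C_1,C_2,C_3$ such that $(C,C_1,C_2,C_3)$ is an equitable partition of $Q_n$ with quotient matrix having $0$ on the diagonal and $r$ in every off-diagonal entry.
   Context: $Q_n$ is the graph on $\{0,1\}^n$ (viewed as $\mathbb F_2^n$) with two words adjacent iff they differ in exactly one position. A partition $(C_i)_{i\in I}$ of the vertices of a graph is equitable with quotient matrix $(S_{i,j})$ if every vertex of $C_i$ has exactly $S_{i,j}$ neighbours in $C_j$. $\overline C$ is the complement of $C$. -}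

module Defs where

open import Data.Bool using (Bool; true; false; _xor_)
open import Data.Nat using (ℕ; zero; suc; _+_; _*_)
open import Data.Nat.Properties using (_≟_)
open import Data.Fin using (Fin)
import Data.Fin.Properties as FinP
open import Data.Vec using (Vec; []; _∷_; zipWith; replicate)
open import Data.List using (List; []; _∷_; map; _++_; length; filter)
open import Data.List.Relation.Unary.All using (All)
open import Data.Product using (Σ; _×_; _,_; ∃)
open import Relation.Nullary using (¬_; Dec; yes; no)
open import Relation.Nullary.Decidable using (_×-dec_)
open import Relation.Binary.PropositionalEquality using (_≡_)

-- Vertices of Q_n: words in {0,1}^n = F_2^n (false = 0, true = 1).
Vertex : ℕ → Set
Vertex n = Vec Bool n

allVertices : (n : ℕ) → List (Vertex n)
allVertices zero = [] ∷ []
allVertices (suc n) = map (false ∷_) (allVertices n) ++ map (true ∷_) (allVertices n)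

hamming : ∀ {n} → Vertex n → Vertex n → ℕ
hamming [] [] = 0
hamming (true ∷ x) (false ∷ y) = suc (hamming x y)
hamming (false ∷ x) (true ∷ y) = suc (hamming x y)
hamming (true ∷ x) (true ∷ y) = hamming x y
hamming (false ∷ x) (false ∷ y) = hamming x y

Adjacent : ∀ {n} → Vertex n → Vertex n → Set
Adjacent x y = hamming x y ≡ 1

-- A partition of V(Q_n) into k (indexed) cells is given by a colouring;
-- cell i is the set of vertices of colour i.
Colouring : ℕ → ℕ → Set
Colouring n k = Vertex n → Fin k

nbrsIn : ∀ {n k} → Colouring n k → Vertex n → Fin k → ℕ
nbrsIn {n} c x j =
  length (filter (λ y → (hamming x y ≟ 1) ×-dec (c y FinP.≟ j)) (allVertices n))

Equitable : ∀ {n k} → Colouring n k → (Fin k → Fin k → ℕ) → Set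
Equitable {n} {k} c S = ∀ (i j : Fin k) (x : Vertex n) → c x ≡ i → nbrsIn c x j ≡ S i j

_⊕_ : ∀ {n} → Vertex n → Vertex n → Vertex n
_⊕_ = zipWith _xor_

sumV : ∀ {n} → List (Vertex n) → Vertex n
sumV {n} [] = replicate n false
sumV (v ∷ vs) = v ⊕ sumV vs

data Odd : ℕ → Set where
  one : Odd 1
  ss  : ∀ {m} → Odd m → Odd (suc (suc m))

-- Affine span over F_2 of a set C: all affine combinations of elements of C,
-- i.e. sums of an odd number of elements of C.
AffSpan : ∀ {n} → (Vertex n → Set) → Vertex n → Set
AffSpan C x = Σ (List _) λ L → All C L × Odd (length L) × sumV L ≡ x

-- Semilinear: affine span of C has dimension < n, i.e. is a proper affine
-- subspace of F_2^n (the only n-dimensional affine subspace is F_2^n itself).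
Semilinear : ∀ {n} → (Vertex n → Set) → Set
Semilinear {n} C = ∃ λ (v : Vertex n) → ¬ AffSpan C v

M2 : ℕ → Fin 2 → Fin 2 → ℕ
M2 r Fin.zero Fin.zero = 0
M2 r Fin.zero (Fin.suc Fin.zero) = 3 * r
M2 r (Fin.suc Fin.zero) Fin.zero = r
M2 r (Fin.suc Fin.zero) (Fin.suc Fin.zero) = 2 * r

M4 : ℕ → Fin 4 → Fin 4 → ℕ
M4 r i j with i FinP.≟ j
... | yes _ = 0
... | no _ = r

module Submission where

-- Semilinearity of C means that the vectors true ∷ x (x ∈ C) do not span F₂ⁿ⁺¹, so Gaussian
-- elimination gives a hyperplane H = {x : a · x = b} containing C (C is nonempty once r > 0).
-- Let s be the weight of a and s̄ = n − s: flips in the support of a cross H, the others stay on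
-- their side. Double counting the edges between C, D = H ∖ C and the complement Hᶜ
-- (|H| = |Hᶜ|, |C| s = |Hᶜ| r, |C| s̄ = |D| r) gives s̄ = r and s = 2r. Hence the s̄ off-support
-- flips of a vertex of H exchange C and D, and every vertex of Hᶜ has exactly r
-- support-neighbours in C. Splitting Hᶜ according to whether flipping a fixed support
-- coordinate j lands in C or in D gives four cells, and every vertex sends r flips into each of
-- the three cells other than its own.

open import Defs
open import Algebra.Bundles using (CommutativeMonoid)
open import Data.Bool using (Bool; true; false; not; _∧_; _xor_)
import Data.Bool as Bool
open import Data.Bool.Properties
  using (∧-comm; ∧-identityʳ; ∧-zeroʳ; ∧-commutativeMonoid; xor-assoc; xor-comm; xor-same;
         xor-identityʳ; xor-inverseʳ; not-involutive; not-injective)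
open import Data.Bool.Solver using (module xor-∧-Solver)
open import Data.Fin using (Fin; zero; suc)
open import Data.Fin.Properties using () renaming (_≟_ to _≟ᶠ_)
open import Data.List using (List; []; _∷_; map; _++_; length; filter; allFin; tabulate)
open import Data.List.Properties using (map-tabulate; length-tabulate)
open import Data.List.Relation.Unary.All using (All; []; _∷_)
import Data.List.Relation.Unary.All as All
open import Data.List.Relation.Unary.All.Properties using (++⁺; ¬Any⇒All¬; map⁻)
open import Data.List.Relation.Unary.Any using (here; there; any?)
open import Data.List.Membership.Propositional using (_∈_; find)
open import Data.List.Membership.Propositional.Properties
  using (∈-allFin; ∈-map⁺; ∈-map⁻; ∈-filter⁺; ∈-filter⁻; ∈-++⁺ˡ; ∈-++⁺ʳ)
open import Data.Nat using (ℕ; zero; suc; _+_; _*_; _<_; s≤s; z≤n; NonZero; >-nonZero)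
open import Data.Nat.Properties
  using (_≟_; +-identityʳ; +-assoc; +-comm; +-cancelˡ-≡; *-cancelˡ-≡; *-cancelʳ-≡;
         *-distribˡ-+; *-distribʳ-+; +-commutativeSemigroup)
open import Data.Nat.Tactic.RingSolver using (solve-∀)
open import Data.Product using (∃; ∃₂; _×_; _,_; proj₁; proj₂)
open import Data.Sum using (_⊎_; inj₁; inj₂)
open import Data.Vec using ([]; _∷_; replicate; lookup; head; updateAt)
open import Data.Vec.Properties using (∷-injective; updateAt-commutes)
open import Function.Bundles using (_⇔_; mk⇔)
open import Relation.Nullary using (does; yes; no; contradiction)
open import Relation.Nullary.Decidable using (_×-dec_)
open import Relation.Unary using (Decidable)
open import Relation.Binary.PropositionalEquality
open import Algebra.Properties.CommutativeSemigroup +-commutativeSemigroup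
  using () renaming (interchange to +-interchange)
open import Algebra.Properties.CommutativeSemigroup
  (CommutativeMonoid.commutativeSemigroup ∧-commutativeMonoid)
  using () renaming (xy∙z≈xz∙y to ∧-rearrange)

private variable
  A B : Set
  n : ℕ

𝟙 : Bool → ℕ
𝟙 true  = 1
𝟙 false = 0

sumBy : (A → ℕ) → List A → ℕ
sumBy f []       = 0
sumBy f (x ∷ xs) = f x + sumBy f xs

count : (A → Bool) → List A → ℕ
count p = sumBy (λ x → 𝟙 (p x))

sumBy-cong : ∀ {f g : A → ℕ} → (∀ x → f x ≡ g x) → ∀ xs → sumBy f xs ≡ sumBy g xs
sumBy-cong f≗g []       = refl
sumBy-cong f≗g (x ∷ xs) = cong₂ _+_ (f≗g x) (sumBy-cong f≗g xs)

sumBy-++ : ∀ (f : A → ℕ) xs ys → sumBy f (xs ++ ys) ≡ sumBy f xs + sumBy f ys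
sumBy-++ f []       ys = refl
sumBy-++ f (x ∷ xs) ys = trans (cong (f x +_) (sumBy-++ f xs ys)) (sym (+-assoc (f x) _ _))

sumBy-map : ∀ (f : B → ℕ) (g : A → B) xs → sumBy f (map g xs) ≡ sumBy (λ x → f (g x)) xs
sumBy-map f g []       = refl
sumBy-map f g (x ∷ xs) = cong (f (g x) +_) (sumBy-map f g xs)

sumBy-+ : ∀ (f g : A → ℕ) xs → sumBy (λ x → f x + g x) xs ≡ sumBy f xs + sumBy g xs
sumBy-+ f g []       = refl
sumBy-+ f g (x ∷ xs) =
  trans (cong ((f x + g x) +_) (sumBy-+ f g xs)) (+-interchange (f x) (g x) _ _)

sumBy-zero : ∀ (xs : List A) → sumBy (λ _ → 0) xs ≡ 0
sumBy-zero []       = refl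
sumBy-zero (x ∷ xs) = sumBy-zero xs

sumBy-comm : ∀ (f : A → B → ℕ) xs ys →
  sumBy (λ x → sumBy (f x) ys) xs ≡ sumBy (λ y → sumBy (λ x → f x y) xs) ys
sumBy-comm f []       ys = sym (sumBy-zero ys)
sumBy-comm f (x ∷ xs) ys =
  trans (cong (sumBy (f x) ys +_) (sumBy-comm f xs ys)) (sym (sumBy-+ (f x) _ ys))

sumBy-𝟙* : ∀ (p : A → Bool) (f : A → ℕ) {m} → (∀ x → p x ≡ true → f x ≡ m) →
  ∀ xs → sumBy (λ x → 𝟙 (p x) * f x) xs ≡ count p xs * m
sumBy-𝟙* p f on-p []       = refl
sumBy-𝟙* p f on-p (x ∷ xs) with p x in px
... | true  = cong₂ _+_ (trans (+-identityʳ (f x)) (on-p x px)) (sumBy-𝟙* p f on-p xs)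
... | false = sumBy-𝟙* p f on-p xs

length-filter : ∀ {P : A → Set} (P? : Decidable P) xs →
  length (filter P? xs) ≡ count (λ x → does (P? x)) xs
length-filter P? []       = refl
length-filter P? (x ∷ xs) with does (P? x)
... | true  = cong suc (length-filter P? xs)
... | false = length-filter P? xs

count-cong : ∀ {p q : A → Bool} → (∀ x → p x ≡ q x) → ∀ xs → count p xs ≡ count q xs
count-cong p≗q = sumBy-cong (λ x → cong 𝟙 (p≗q x))

count-∧-cong : ∀ (g : A → Bool) {p q : A → Bool} → (∀ x → g x ≡ true → p x ≡ q x) →
  ∀ xs → count (λ x → g x ∧ p x) xs ≡ count (λ x → g x ∧ q x) xs
count-∧-cong g {p} {q} p≗q = count-cong pointwise
  where
  pointwise : ∀ x → g x ∧ p x ≡ g x ∧ q x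
  pointwise x with g x in gx
  ... | true  = p≗q x gx
  ... | false = refl

count-true : ∀ (xs : List A) → count (λ _ → true) xs ≡ length xs
count-true []       = refl
count-true (x ∷ xs) = cong suc (count-true xs)

count-split : ∀ (g p : A → Bool) xs →
  count p xs ≡ count (λ x → g x ∧ p x) xs + count (λ x → not (g x) ∧ p x) xs
count-split g p xs = trans (sumBy-cong pointwise xs) (sumBy-+ _ _ xs)
  where
  pointwise : ∀ x → 𝟙 (p x) ≡ 𝟙 (g x ∧ p x) + 𝟙 (not (g x) ∧ p x)
  pointwise x with g x
  ... | true  = sym (+-identityʳ _)
  ... | false = refl

count-partition : ∀ (g p : A → Bool) xs →
  count g xs ≡ count (λ x → g x ∧ p x) xs + count (λ x → g x ∧ not (p x)) xs
count-partition g p xs = trans (count-split p g xs)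
  (cong₂ _+_ (count-cong (λ x → ∧-comm (p x) (g x)) xs) (count-cong (λ x → ∧-comm (not (p x)) (g x)) xs))

count-∧-const : ∀ (g : A → Bool) b xs → count (λ x → g x ∧ b) xs ≡ 𝟙 b * count g xs
count-∧-const g true  xs = trans (count-cong (λ x → ∧-identityʳ (g x)) xs) (sym (+-identityʳ _))
count-∧-const g false xs = trans (count-cong (λ x → ∧-zeroʳ (g x)) xs) (sumBy-zero xs)

count-∧-false : ∀ (g : A → Bool) {p : A → Bool} → (∀ x → g x ≡ true → p x ≡ false) →
  ∀ xs → count (λ x → g x ∧ p x) xs ≡ 0
count-∧-false g g⇒¬p xs = trans (count-∧-cong g g⇒¬p xs) (count-∧-const g false xs)

count-∧-image : ∀ (g q : A → Bool) (F : Bool → Bool) xs →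
  count (λ x → g x ∧ F (q x)) xs
    ≡ 𝟙 (F true) * count (λ x → g x ∧ q x) xs + 𝟙 (F false) * count (λ x → g x ∧ not (q x)) xs
count-∧-image g q F xs = begin
  count (λ x → g x ∧ F (q x)) xs
    ≡⟨ count-split q _ xs ⟩
  count (λ x → q x ∧ (g x ∧ F (q x))) xs + count (λ x → not (q x) ∧ (g x ∧ F (q x))) xs
    ≡⟨ cong₂ _+_ (count-cong on-q xs) (count-cong off-q xs) ⟩
  count (λ x → (g x ∧ q x) ∧ F true) xs + count (λ x → (g x ∧ not (q x)) ∧ F false) xs
    ≡⟨ cong₂ _+_ (count-∧-const _ (F true) xs) (count-∧-const _ (F false) xs) ⟩
  𝟙 (F true) * count (λ x → g x ∧ q x) xs + 𝟙 (F false) * count (λ x → g x ∧ not (q x)) xs ∎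
  where
  open ≡-Reasoning
  on-q : ∀ x → q x ∧ (g x ∧ F (q x)) ≡ (g x ∧ q x) ∧ F true
  on-q x with g x | q x
  ... | true  | true  = refl
  ... | true  | false = refl
  ... | false | true  = refl
  ... | false | false = refl
  off-q : ∀ x → not (q x) ∧ (g x ∧ F (q x)) ≡ (g x ∧ not (q x)) ∧ F false
  off-q x with g x | q x
  ... | true  | true  = refl
  ... | true  | false = refl
  ... | false | true  = refl
  ... | false | false = refl

count≡0⇒false : ∀ {p : A → Bool} {xs x} → count p xs ≡ 0 → x ∈ xs → p x ≡ false
count≡0⇒false {p = p} {y ∷ xs} none (here refl) with p y
... | false = refl
count≡0⇒false {p = p} {y ∷ xs} none (there x∈xs) with p y
... | false = count≡0⇒false none x∈xs

∈⇒count>0 : ∀ {p : A → Bool} {xs x} → x ∈ xs → p x ≡ true → 0 < count p xs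
∈⇒count>0 {p = p} {xs} x∈xs px with count p xs in eq
... | suc _ = s≤s z≤n
... | zero  = contradiction (trans (sym px) (count≡0⇒false eq x∈xs)) λ ()

count>0⇒∃ : ∀ {p : A → Bool} xs → 0 < count p xs → ∃ λ x → p x ≡ true
count>0⇒∃ {p = p} (x ∷ xs) pos with p x in px
... | true  = x , px
... | false = count>0⇒∃ xs pos

count-∧≡count⇒ : ∀ {g p : A → Bool} {xs x} → count (λ y → g y ∧ p y) xs ≡ count g xs →
  x ∈ xs → g x ≡ true → p x ≡ true
count-∧≡count⇒ {g = g} {p} {xs} {x} full x∈xs gx = p≡true (count≡0⇒false rest≡0 x∈xs)
  where
  open ≡-Reasoning
  rest≡0 : count (λ y → g y ∧ not (p y)) xs ≡ 0
  rest≡0 = +-cancelˡ-≡ (count g xs) _ 0 (begin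
    count g xs + count (λ y → g y ∧ not (p y)) xs
      ≡⟨ cong (_+ count (λ y → g y ∧ not (p y)) xs) full ⟨
    count (λ y → g y ∧ p y) xs + count (λ y → g y ∧ not (p y)) xs
      ≡⟨ count-partition g p xs ⟨
    count g xs
      ≡⟨ +-identityʳ _ ⟨
    count g xs + 0 ∎)
  p≡true : g x ∧ not (p x) ≡ false → p x ≡ true
  p≡true rewrite gx with p x
  ... | true = λ _ → refl

0ᵥ : ∀ n → Vertex n
0ᵥ n = replicate n false

infixl 7 _·_
_·_ : Vertex n → Vertex n → Bool
[]       · []       = false
(a ∷ as) · (x ∷ xs) = (a ∧ x) xor (as · xs)

IsNonzero : Vertex n → Set
IsNonzero a = ∃ λ i → lookup a i ≡ true

⊕-identityˡ : ∀ (x : Vertex n) → 0ᵥ n ⊕ x ≡ x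
⊕-identityˡ []      = refl
⊕-identityˡ (b ∷ x) = cong (b ∷_) (⊕-identityˡ x)

⊕-identityʳ : ∀ (x : Vertex n) → x ⊕ 0ᵥ n ≡ x
⊕-identityʳ []      = refl
⊕-identityʳ (b ∷ x) = cong₂ _∷_ (xor-identityʳ b) (⊕-identityʳ x)

⊕-assoc : ∀ (x y z : Vertex n) → (x ⊕ y) ⊕ z ≡ x ⊕ (y ⊕ z)
⊕-assoc []      []      []      = refl
⊕-assoc (a ∷ x) (b ∷ y) (c ∷ z) = cong₂ _∷_ (xor-assoc a b c) (⊕-assoc x y z)

⊕-cancelˡ : ∀ (x y : Vertex n) → x ⊕ (x ⊕ y) ≡ y
⊕-cancelˡ []      []      = refl
⊕-cancelˡ (a ∷ x) (b ∷ y) =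
  cong₂ _∷_ (trans (sym (xor-assoc a a b)) (cong (_xor b) (xor-same a))) (⊕-cancelˡ x y)

sumV-++ : ∀ (L M : List (Vertex n)) → sumV (L ++ M) ≡ sumV L ⊕ sumV M
sumV-++ []      M = sym (⊕-identityˡ (sumV M))
sumV-++ (v ∷ L) M = trans (cong (v ⊕_) (sumV-++ L M)) (sym (⊕-assoc v (sumV L) (sumV M)))

0ᵥ-· : ∀ (x : Vertex n) → 0ᵥ n · x ≡ false
0ᵥ-· []      = refl
0ᵥ-· (_ ∷ x) = 0ᵥ-· x

·-distribˡ-⊕ : ∀ (a x y : Vertex n) → a · (x ⊕ y) ≡ a · x xor a · y
·-distribˡ-⊕ []       []       []       = refl
·-distribˡ-⊕ (a ∷ as) (x ∷ xs) (y ∷ ys) rewrite ·-distribˡ-⊕ as xs ys =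
  solve 5 (λ a x y p q → (a :* (x :+ y)) :+ (p :+ q) := ((a :* x) :+ p) :+ ((a :* y) :+ q))
    refl a x y (as · xs) (as · ys)
  where open xor-∧-Solver

·≡true⇒nonzero : ∀ (a x : Vertex n) → a · x ≡ true → IsNonzero a
·≡true⇒nonzero []          []          ()
·≡true⇒nonzero (true ∷ a)  (true ∷ x)  _  = zero , refl
·≡true⇒nonzero (true ∷ a)  (false ∷ x) ax = let i , ai = ·≡true⇒nonzero a x ax in suc i , ai
·≡true⇒nonzero (false ∷ a) (_ ∷ x)     ax = let i , ai = ·≡true⇒nonzero a x ax in suc i , ai

-- Gaussian elimination

InSpan : List (Vertex n) → Vertex n → Set
InSpan G v = ∃ λ L → All (_∈ G) L × sumV L ≡ v

Annihilated : List (Vertex n) → Set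
Annihilated {n} G = ∃ λ (a : Vertex n) → IsNonzero a × All (λ g → a · g ≡ false) G

span-0 : ∀ (G : List (Vertex n)) → InSpan G (0ᵥ n)
span-0 G = [] , [] , refl

span-gen : ∀ {G : List (Vertex n)} {g} → g ∈ G → InSpan G g
span-gen {g = g} g∈G = g ∷ [] , g∈G ∷ [] , ⊕-identityʳ g

span-⊕ : ∀ {G : List (Vertex n)} {u v} → InSpan G u → InSpan G v → InSpan G (u ⊕ v)
span-⊕ (L , L⊆G , refl) (M , M⊆G , refl) = L ++ M , ++⁺ L⊆G M⊆G , sumV-++ L M

-- Clearing the first coordinate with the pivot row true ∷ t₀.
reduce : Vertex n → Vertex (suc n) → Vertex n
reduce t₀ (false ∷ t) = t
reduce t₀ (true ∷ t)  = t ⊕ t₀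

reduce-annihilated : ∀ {G : List (Vertex (suc n))} t₀ → Annihilated (map (reduce t₀) G) → Annihilated G
reduce-annihilated t₀ (a , (i , ai) , a⊥) =
  (a · t₀ ∷ a) , (suc i , ai) , All.map (λ {g} → extend g) (map⁻ a⊥)
  where
  extend : ∀ g → a · reduce t₀ g ≡ false → (a · t₀ ∷ a) · g ≡ false
  extend (false ∷ t) a⊥g = trans (cong (_xor a · t) (∧-zeroʳ (a · t₀))) a⊥g
  extend (true ∷ t)  a⊥g = begin
    (a · t₀ ∧ true) xor a · t ≡⟨ cong (_xor a · t) (∧-identityʳ (a · t₀)) ⟩
    a · t₀ xor a · t          ≡⟨ xor-comm (a · t₀) (a · t) ⟩
    a · t xor a · t₀          ≡⟨ ·-distribˡ-⊕ a t t₀ ⟨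
    a · (t ⊕ t₀)              ≡⟨ a⊥g ⟩
    false                     ∎
    where open ≡-Reasoning

reduce-span : ∀ {G : List (Vertex (suc n))} {t₀ w} → (true ∷ t₀) ∈ G →
  InSpan (map (reduce t₀) G) w → InSpan G (false ∷ w)
reduce-span {G = G} {t₀} pivot (L , L⊆ , refl) = lift L⊆
  where
  lift : ∀ {L} → All (_∈ map (reduce t₀) G) L → InSpan G (false ∷ sumV L)
  lift []        = span-0 G
  lift (h∈ ∷ L⊆) with ∈-map⁻ (reduce t₀) h∈
  ... | false ∷ t , g∈G , refl = span-⊕ (span-gen g∈G) (lift L⊆)
  ... | true ∷ t  , g∈G , refl = span-⊕ (span-⊕ (span-gen g∈G) (span-gen pivot)) (lift L⊆)

reduce-spanning : ∀ {G : List (Vertex (suc n))} {t₀} → (true ∷ t₀) ∈ G →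
  (∀ v → InSpan (map (reduce t₀) G) v) → ∀ v → InSpan G v
reduce-spanning pivot spans (false ∷ w) = reduce-span pivot (spans w)
reduce-spanning {G = G} {t₀} pivot spans (true ∷ w) =
  subst (InSpan G) (cong (true ∷_) (⊕-cancelˡ t₀ w))
    (span-⊕ (span-gen pivot) (reduce-span pivot (spans (t₀ ⊕ w))))

annihilated-or-spanning : ∀ n (G : List (Vertex n)) → Annihilated G ⊎ (∀ v → InSpan G v)
annihilated-or-spanning zero    G = inj₂ λ { [] → span-0 G }
annihilated-or-spanning (suc n) G with any? (λ g → head g Bool.≟ true) G
... | no  no-pivot =
  inj₁ (true ∷ 0ᵥ n , (zero , refl) , All.map (λ {g} → first-false g) (¬Any⇒All¬ G no-pivot))
  where
  first-false : ∀ g → head g ≢ true → (true ∷ 0ᵥ n) · g ≡ false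
  first-false (false ∷ t) _  = 0ᵥ-· t
  first-false (true ∷ t)  ¬t = contradiction refl ¬t
... | yes pivot with find pivot
...   | true ∷ t₀ , pivot∈G , _ with annihilated-or-spanning n (map (reduce t₀) G)
...     | inj₁ annihilated = inj₁ (reduce-annihilated t₀ annihilated)
...     | inj₂ spanning    = inj₂ (reduce-spanning pivot∈G spanning)

-- Semilinear sets lie in hyperplanes

∈-allVertices : ∀ (x : Vertex n) → x ∈ allVertices n
∈-allVertices []                 = here refl
∈-allVertices (false ∷ x)        = ∈-++⁺ˡ (∈-map⁺ (false ∷_) (∈-allVertices x))
∈-allVertices {suc n} (true ∷ x) =
  ∈-++⁺ʳ (map (false ∷_) (allVertices n)) (∈-map⁺ (true ∷_) (∈-allVertices x))

isOdd : ℕ → Bool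
isOdd zero    = false
isOdd (suc m) = not (isOdd m)

isOdd⇒Odd : ∀ m → isOdd m ≡ true → Odd m
isOdd⇒Odd (suc zero)    _ = one
isOdd⇒Odd (suc (suc m)) e = ss (isOdd⇒Odd m (trans (sym (not-involutive (isOdd m))) e))

sumV-map-true∷ : ∀ (L : List (Vertex n)) → sumV (map (true ∷_) L) ≡ isOdd (length L) ∷ sumV L
sumV-map-true∷ []      = refl
sumV-map-true∷ (v ∷ L) = cong ((true ∷ v) ⊕_) (sumV-map-true∷ L)

All-∈-map⁻ : ∀ {f : A → B} {xs L} → All (_∈ map f xs) L → ∃ λ L′ → All (_∈ xs) L′ × L ≡ map f L′
All-∈-map⁻ [] = [] , [] , refl
All-∈-map⁻ {f = f} (y∈ ∷ L⊆) with ∈-map⁻ f y∈ | All-∈-map⁻ L⊆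
... | x , x∈ , refl | L′ , L′⊆ , refl = x ∷ L′ , x∈ ∷ L′⊆ , refl

semilinear⇒hyperplane : ∀ {P : Vertex n → Set} (P? : Decidable P) → Semilinear P → ∀ {x₀} → P x₀ →
  ∃₂ λ a b → IsNonzero a × (∀ x → P x → a · x ≡ b)
semilinear⇒hyperplane {n} {P} P? (v , v∉span) {x₀} Px₀
  with annihilated-or-spanning (suc n) (map (true ∷_) (filter P? (allVertices n)))
... | inj₁ (b ∷ a , (i , ai) , a⊥) = a , b , nonzero i ai , on-P
  where
  on-P : ∀ x → P x → a · x ≡ b
  on-P x Px = xor-false b (a · x) (All.lookup a⊥ (∈-map⁺ (true ∷_) (∈-filter⁺ P? (∈-allVertices x) Px)))
    where
    xor-false : ∀ b p → (b ∧ true) xor p ≡ false → p ≡ b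
    xor-false true  true  _ = refl
    xor-false false false _ = refl
  nonzero : ∀ i → lookup (b ∷ a) i ≡ true → IsNonzero a
  nonzero zero    b≡true = ·≡true⇒nonzero a x₀ (trans (on-P x₀ Px₀) b≡true)
  nonzero (suc i) ai     = i , ai
... | inj₂ spans with spans (true ∷ v)
...   | L , L⊆ , sumL with All-∈-map⁻ L⊆
...     | L′ , L′⊆ , refl with ∷-injective (trans (sym (sumV-map-true∷ L′)) sumL)
...       | odd , sumL′ = contradiction (L′ , L′⊆P , isOdd⇒Odd (length L′) odd , sumL′) v∉span
  where
  L′⊆P : All P L′
  L′⊆P = All.map (λ x∈ → proj₂ (∈-filter⁻ P? {xs = allVertices n} x∈)) L′⊆

-- Neighbourhoods in Qₙ

flipAt : Fin n → Vertex n → Vertex n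
flipAt i x = updateAt x i not

flipAt-comm : ∀ (i k : Fin n) x → flipAt i (flipAt k x) ≡ flipAt k (flipAt i x)
flipAt-comm i k x with i ≟ᶠ k
... | yes refl = refl
... | no  i≢k  = updateAt-commutes i k i≢k x

·-flipAt : ∀ (a x : Vertex n) i → a · flipAt i x ≡ a · x xor lookup a i
·-flipAt (u ∷ a) (v ∷ x) zero =
  solve 3 (λ u v p → (u :* (con true :+ v)) :+ p := ((u :* v) :+ p) :+ u) refl u v (a · x)
  where open xor-∧-Solver
·-flipAt (u ∷ a) (v ∷ x) (suc i) =
  trans (cong ((u ∧ v) xor_) (·-flipAt a x i)) (sym (xor-assoc (u ∧ v) (a · x) (lookup a i)))

nbrCount : Vertex n → (Vertex n → Bool) → ℕ
nbrCount {n} x P = count (λ i → P (flipAt i x)) (allFin n)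

adjacent? : Vertex n → Vertex n → Bool
adjacent? x y = does (hamming x y ≟ 1)

count-allVertices : ∀ (p : Vertex (suc n) → Bool) →
  count p (allVertices (suc n))
    ≡ count (λ y → p (false ∷ y)) (allVertices n) + count (λ y → p (true ∷ y)) (allVertices n)
count-allVertices {n} p = trans (sumBy-++ _ (map (false ∷_) (allVertices n)) _)
  (cong₂ _+_ (sumBy-map _ _ (allVertices n)) (sumBy-map _ _ (allVertices n)))

nbrCount-∷ : ∀ b (x : Vertex n) P → nbrCount (b ∷ x) P ≡ 𝟙 (P (not b ∷ x)) + nbrCount x (λ y → P (b ∷ y))
nbrCount-∷ {n} b x P = cong (𝟙 (P (not b ∷ x)) +_) (begin
  count (λ i → P (flipAt i (b ∷ x))) (tabulate suc)
    ≡⟨ cong (count (λ i → P (flipAt i (b ∷ x)))) (map-tabulate {n = n} (λ i → i) suc) ⟨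
  count (λ i → P (flipAt i (b ∷ x))) (map suc (allFin n))
    ≡⟨ sumBy-map (λ i → 𝟙 (P (flipAt i (b ∷ x)))) suc (allFin n) ⟩
  nbrCount x (λ y → P (b ∷ y)) ∎)
  where open ≡-Reasoning

count-at-distance-0 : ∀ (x : Vertex n) P →
  count (λ y → does (hamming x y ≟ 0) ∧ P y) (allVertices n) ≡ 𝟙 (P x)
count-at-distance-0 []                  P = +-identityʳ _
count-at-distance-0 {suc n} (false ∷ x) P = begin
  count (λ y → does (hamming (false ∷ x) y ≟ 0) ∧ P y) (allVertices (suc n))
    ≡⟨ count-allVertices (λ y → does (hamming (false ∷ x) y ≟ 0) ∧ P y) ⟩
  count (λ y → does (hamming x y ≟ 0) ∧ P (false ∷ y)) (allVertices n) + sumBy (λ _ → 0) (allVertices n)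
    ≡⟨ cong₂ _+_ (count-at-distance-0 x (λ y → P (false ∷ y))) (sumBy-zero (allVertices n)) ⟩
  𝟙 (P (false ∷ x)) + 0
    ≡⟨ +-identityʳ _ ⟩
  𝟙 (P (false ∷ x)) ∎
  where open ≡-Reasoning
count-at-distance-0 {suc n} (true ∷ x) P =
  trans (count-allVertices (λ y → does (hamming (true ∷ x) y ≟ 0) ∧ P y))
        (cong₂ _+_ (sumBy-zero (allVertices n)) (count-at-distance-0 x (λ y → P (true ∷ y))))

count-adjacent : ∀ (x : Vertex n) P → count (λ y → adjacent? x y ∧ P y) (allVertices n) ≡ nbrCount x P
count-adjacent []                  P = refl
count-adjacent {suc n} (false ∷ x) P = begin
  count (λ y → adjacent? (false ∷ x) y ∧ P y) (allVertices (suc n))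
    ≡⟨ count-allVertices (λ y → adjacent? (false ∷ x) y ∧ P y) ⟩
  count (λ y → adjacent? x y ∧ P (false ∷ y)) (allVertices n)
    + count (λ y → does (hamming x y ≟ 0) ∧ P (true ∷ y)) (allVertices n)
    ≡⟨ cong₂ _+_ (count-adjacent x (λ y → P (false ∷ y))) (count-at-distance-0 x (λ y → P (true ∷ y))) ⟩
  nbrCount x (λ y → P (false ∷ y)) + 𝟙 (P (true ∷ x))
    ≡⟨ +-comm (nbrCount x (λ y → P (false ∷ y))) (𝟙 (P (true ∷ x))) ⟩
  𝟙 (P (true ∷ x)) + nbrCount x (λ y → P (false ∷ y))
    ≡⟨ nbrCount-∷ false x P ⟨
  nbrCount (false ∷ x) P ∎
  where open ≡-Reasoning
count-adjacent {suc n} (true ∷ x) P = begin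
  count (λ y → adjacent? (true ∷ x) y ∧ P y) (allVertices (suc n))
    ≡⟨ count-allVertices (λ y → adjacent? (true ∷ x) y ∧ P y) ⟩
  count (λ y → does (hamming x y ≟ 0) ∧ P (false ∷ y)) (allVertices n)
    + count (λ y → adjacent? x y ∧ P (true ∷ y)) (allVertices n)
    ≡⟨ cong₂ _+_ (count-at-distance-0 x (λ y → P (false ∷ y))) (count-adjacent x (λ y → P (true ∷ y))) ⟩
  𝟙 (P (false ∷ x)) + nbrCount x (λ y → P (true ∷ y))
    ≡⟨ nbrCount-∷ true x P ⟨
  nbrCount (true ∷ x) P ∎
  where open ≡-Reasoning

nbrsIn≡nbrCount : ∀ {k} (c : Colouring n k) x j → nbrsIn c x j ≡ nbrCount x (λ y → does (c y ≟ᶠ j))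
nbrsIn≡nbrCount {n} c x j =
  trans (length-filter (λ y → (hamming x y ≟ 1) ×-dec (c y ≟ᶠ j)) (allVertices n)) (count-adjacent x _)

hamming-sym : ∀ (x y : Vertex n) → hamming x y ≡ hamming y x
hamming-sym []          []          = refl
hamming-sym (true ∷ x)  (true ∷ y)  = hamming-sym x y
hamming-sym (true ∷ x)  (false ∷ y) = cong suc (hamming-sym x y)
hamming-sym (false ∷ x) (true ∷ y)  = cong suc (hamming-sym x y)
hamming-sym (false ∷ x) (false ∷ y) = hamming-sym x y

edgeCount : (A B : Vertex n → Bool) → ℕ
edgeCount {n} A B = sumBy (λ x → 𝟙 (A x) * nbrCount x B) (allVertices n)

edgeCount-comm : ∀ (A B : Vertex n → Bool) → edgeCount A B ≡ edgeCount B A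
edgeCount-comm {n} A B = begin
  edgeCount A B                                               ≡⟨ sumBy-cong (as-count A B) V ⟩
  sumBy (λ x → count (λ y → (adjacent? x y ∧ B y) ∧ A x) V) V ≡⟨ sumBy-comm _ V V ⟩
  sumBy (λ y → count (λ x → (adjacent? x y ∧ B y) ∧ A x) V) V ≡⟨ sumBy-cong (λ y → count-cong (swap y) V) V ⟩
  sumBy (λ y → count (λ x → (adjacent? y x ∧ A x) ∧ B y) V) V ≡⟨ sumBy-cong (as-count B A) V ⟨
  edgeCount B A                                               ∎
  where
  open ≡-Reasoning
  V = allVertices n
  as-count : ∀ A B x → 𝟙 (A x) * nbrCount x B ≡ count (λ y → (adjacent? x y ∧ B y) ∧ A x) V
  as-count A B x = trans (cong (𝟙 (A x) *_) (sym (count-adjacent x B))) (sym (count-∧-const _ (A x) V))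
  swap : ∀ y x → (adjacent? x y ∧ B y) ∧ A x ≡ (adjacent? y x ∧ A x) ∧ B y
  swap y x rewrite hamming-sym x y = ∧-rearrange (adjacent? y x) (B y) (A x)

double-count : ∀ (A B : Vertex n → Bool) {p q} →
  (∀ x → A x ≡ true → nbrCount x B ≡ p) → (∀ y → B y ≡ true → nbrCount y A ≡ q) →
  count A (allVertices n) * p ≡ count B (allVertices n) * q
double-count {n} A B {p} {q} A→p B→q = begin
  count A (allVertices n) * p ≡⟨ sumBy-𝟙* A _ A→p (allVertices n) ⟨
  edgeCount A B               ≡⟨ edgeCount-comm A B ⟩
  edgeCount B A               ≡⟨ sumBy-𝟙* B _ B→q (allVertices n) ⟩
  count B (allVertices n) * q ∎
  where open ≡-Reasoning

-- The four cells

support-sizes : ∀ m d s s̄ r .{{_ : NonZero m}} →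
  m * s ≡ (m + d) * r → m * s̄ ≡ d * r → s + s̄ ≡ 3 * r → s̄ ≡ r × s ≡ 2 * r
support-sizes m d s s̄ r ms≡ ms̄≡ s+s̄≡ = s̄≡r , trans s≡r+s̄ (trans (cong (r +_) s̄≡r) (double r))
  where
  open ≡-Reasoning
  shuffle : ∀ r t → r + 2 * t ≡ (r + t) + t
  shuffle = solve-∀
  three : ∀ r → 3 * r ≡ r + 2 * r
  three = solve-∀
  double : ∀ r → r + r ≡ 2 * r
  double = solve-∀
  s≡r+s̄ : s ≡ r + s̄
  s≡r+s̄ = *-cancelˡ-≡ s (r + s̄) m (begin
    m * s         ≡⟨ ms≡ ⟩
    (m + d) * r   ≡⟨ *-distribʳ-+ r m d ⟩
    m * r + d * r ≡⟨ cong (m * r +_) ms̄≡ ⟨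
    m * r + m * s̄ ≡⟨ *-distribˡ-+ m r s̄ ⟨
    m * (r + s̄)   ∎)
  s̄≡r : s̄ ≡ r
  s̄≡r = *-cancelˡ-≡ s̄ r 2 (+-cancelˡ-≡ r _ _ (begin
    r + 2 * s̄     ≡⟨ shuffle r s̄ ⟩
    (r + s̄) + s̄   ≡⟨ cong (_+ s̄) s≡r+s̄ ⟨
    s + s̄         ≡⟨ s+s̄≡ ⟩
    3 * r         ≡⟨ three r ⟩
    r + 2 * r     ∎))

code : Bool → Bool → Fin 4
code false true  = zero
code false false = suc zero
code true  true  = suc (suc zero)
code true  false = suc (suc (suc zero))

code-false-≟-zero : ∀ (u : Fin 2) → (code false (does (u ≟ᶠ zero)) ≡ zero) ⇔ (u ≡ zero)
code-false-≟-zero zero       = mk⇔ (λ _ → refl) (λ _ → refl)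
code-false-≟-zero (suc zero) = mk⇔ (λ ()) (λ ())

code-true≢zero : ∀ t → code true t ≢ zero
code-true≢zero true  ()
code-true≢zero false ()

M4≡ : ∀ r u k → M4 r u k ≡ 𝟙 (not (does (u ≟ᶠ k))) * r
M4≡ r u k with u ≟ᶠ k
... | yes _ = refl
... | no  _ = sym (+-identityʳ r)

M4-code : ∀ r h t k →
  (𝟙 (does (code (not h) true ≟ᶠ k)) * r + 𝟙 (does (code (not h) false ≟ᶠ k)) * r)
    + 𝟙 (does (code h (not t) ≟ᶠ k)) * r
    ≡ M4 r (code h t) k
M4-code r h t k = begin
  (𝟙 (P true) * r + 𝟙 (P false) * r) + 𝟙 N * r
    ≡⟨ cong (_+ 𝟙 N * r) (*-distribʳ-+ r (𝟙 (P true)) (𝟙 (P false))) ⟨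
  (𝟙 (P true) + 𝟙 (P false)) * r + 𝟙 N * r
    ≡⟨ *-distribʳ-+ r (𝟙 (P true) + 𝟙 (P false)) (𝟙 N) ⟨
  (𝟙 (P true) + 𝟙 (P false) + 𝟙 N) * r
    ≡⟨ cong (_* r) (others h t k) ⟩
  𝟙 (not (does (code h t ≟ᶠ k))) * r
    ≡⟨ M4≡ r (code h t) k ⟨
  M4 r (code h t) k ∎
  where
  open ≡-Reasoning
  P : Bool → Bool
  P u = does (code (not h) u ≟ᶠ k)
  N : Bool
  N = does (code h (not t) ≟ᶠ k)
  others : ∀ h t k →
    𝟙 (does (code (not h) true ≟ᶠ k)) + 𝟙 (does (code (not h) false ≟ᶠ k)) + 𝟙 (does (code h (not t) ≟ᶠ k))
      ≡ 𝟙 (not (does (code h t ≟ᶠ k)))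
  others false false zero                   = refl
  others false false (suc zero)             = refl
  others false false (suc (suc zero))       = refl
  others false false (suc (suc (suc zero))) = refl
  others false true  zero                   = refl
  others false true  (suc zero)             = refl
  others false true  (suc (suc zero))       = refl
  others false true  (suc (suc (suc zero))) = refl
  others true  false zero                   = refl
  others true  false (suc zero)             = refl
  others true  false (suc (suc zero))       = refl
  others true  false (suc (suc (suc zero))) = refl
  others true  true  zero                   = refl
  others true  true  (suc zero)             = refl
  others true  true  (suc (suc zero))       = refl
  others true  true  (suc (suc (suc zero))) = refl

module SplitByHyperplane
  {n r : ℕ} (n≡3r : n ≡ 3 * r) (c : Colouring n 2) (equitable : Equitable c (M2 r))
  (a : Vertex n) (b : Bool) (C⊆H : ∀ x → c x ≡ zero → a · x ≡ b)
  (j : Fin n) (j∈supp : lookup a j ≡ true) (x₀ : Vertex n) (x₀∈C : c x₀ ≡ zero)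
  where

  V : List (Vertex n)
  V = allVertices n

  inC : Vertex n → Bool
  inC x = does (c x ≟ᶠ zero)

  outside : Vertex n → Bool
  outside x = a · x xor b

  inside : Vertex n → Bool
  inside x = not (outside x)

  D : Vertex n → Bool
  D x = not (inC x) ∧ inside x

  supp : Fin n → Bool
  supp = lookup a

  s s̄ : ℕ
  s = count supp (allFin n)
  s̄ = count (λ i → not (supp i)) (allFin n)

  suppCount offSuppCount : Vertex n → (Vertex n → Bool) → ℕ
  suppCount    x P = count (λ i → supp i ∧ P (flipAt i x)) (allFin n)
  offSuppCount x P = count (λ i → not (supp i) ∧ P (flipAt i x)) (allFin n)

  nbrCount-split : ∀ x P → nbrCount x P ≡ suppCount x P + offSuppCount x P
  nbrCount-split x P = count-split supp (λ i → P (flipAt i x)) (allFin n)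

  outside-flipAt : ∀ x i → outside (flipAt i x) ≡ outside x xor supp i
  outside-flipAt x i = trans (cong (_xor b) (·-flipAt a x i))
    (solve 3 (λ p u b → (p :+ u) :+ b := (p :+ b) :+ u) refl (a · x) (supp i) b)
    where open xor-∧-Solver

  outside-flipAt-¬supp : ∀ {x i} → supp i ≡ false → outside (flipAt i x) ≡ outside x
  outside-flipAt-¬supp {x} {i} i∉supp =
    trans (outside-flipAt x i) (trans (cong (outside x xor_) i∉supp) (xor-identityʳ (outside x)))

  outside-flipAt-supp : ∀ {x i} → supp i ≡ true → outside (flipAt i x) ≡ not (outside x)
  outside-flipAt-supp {x} {i} i∈supp =
    trans (outside-flipAt x i) (trans (cong (outside x xor_) i∈supp) (xor-comm (outside x) true))

  inC⇒c≡0 : ∀ {x} → inC x ≡ true → c x ≡ zero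
  inC⇒c≡0 {x} x∈C with c x
  ... | zero = refl

  ¬inC⇒c≡1 : ∀ {x} → inC x ≡ false → c x ≡ suc zero
  ¬inC⇒c≡1 {x} x∉C with c x
  ... | suc zero = refl

  c≡0⇒inC : ∀ {x} → c x ≡ zero → inC x ≡ true
  c≡0⇒inC x∈C rewrite x∈C = refl

  C-inside : ∀ {x} → inC x ≡ true → outside x ≡ false
  C-inside {x} x∈C = trans (cong (_xor b) (C⊆H x (inC⇒c≡0 x∈C))) (xor-same b)

  outside⇒¬inC : ∀ {x} → outside x ≡ true → inC x ≡ false
  outside⇒¬inC {x} x-out with inC x in x∈C
  ... | true  = contradiction (trans (sym x-out) (C-inside x∈C)) λ ()
  ... | false = refl

  nbrCount-C : ∀ x → nbrCount x inC ≡ M2 r (c x) zero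
  nbrCount-C x = trans (sym (nbrsIn≡nbrCount c x zero)) (equitable (c x) zero x refl)

  nbrCount-C-of-C : ∀ {x} → inC x ≡ true → nbrCount x inC ≡ 0
  nbrCount-C-of-C {x} x∈C = trans (nbrCount-C x) (cong (λ k → M2 r k zero) (inC⇒c≡0 x∈C))

  nbrCount-C-of-¬C : ∀ {x} → inC x ≡ false → nbrCount x inC ≡ r
  nbrCount-C-of-¬C {x} x∉C = trans (nbrCount-C x) (cong (λ k → M2 r k zero) (¬inC⇒c≡1 x∉C))

  flipAt-C-¬C : ∀ {x} i → inC x ≡ true → inC (flipAt i x) ≡ false
  flipAt-C-¬C i x∈C = count≡0⇒false (nbrCount-C-of-C x∈C) (∈-allFin i)

  nbrCount-outside-of-inside : ∀ {x} → outside x ≡ false → nbrCount x outside ≡ s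
  nbrCount-outside-of-inside {x} x-in =
    count-cong (λ i → trans (outside-flipAt x i) (cong (_xor supp i) x-in)) (allFin n)

  nbrCount-inside-of-outside : ∀ {y} → outside y ≡ true → nbrCount y inside ≡ s
  nbrCount-inside-of-outside {y} y-out = count-cong
    (λ i → trans (cong not (trans (outside-flipAt y i) (cong (_xor supp i) y-out))) (not-involutive (supp i)))
    (allFin n)

  nbrCount-D-of-C : ∀ {x} → inC x ≡ true → nbrCount x D ≡ s̄
  nbrCount-D-of-C {x} x∈C = count-cong pointwise (allFin n)
    where
    pointwise : ∀ i → D (flipAt i x) ≡ not (supp i)
    pointwise i rewrite flipAt-C-¬C i x∈C =
      cong not (trans (outside-flipAt x i) (cong (_xor supp i) (C-inside x∈C)))

  D⇒¬inC : ∀ {y} → D y ≡ true → inC y ≡ false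
  D⇒¬inC {y} y∈D with inC y
  ... | false = refl

  |H|≡|C|+|D| : count inside V ≡ count inC V + count D V
  |H|≡|C|+|D| = trans (count-split inC inside V) (cong (_+ count D V) (count-cong C∩H≡C V))
    where
    C∩H≡C : ∀ x → inC x ∧ inside x ≡ inC x
    C∩H≡C x with inC x in x∈C
    ... | true  = cong not (C-inside x∈C)
    ... | false = refl

  |H|≡|Hᶜ| : count inside V ≡ count outside V
  |H|≡|Hᶜ| = *-cancelʳ-≡ _ _ s {{>-nonZero (∈⇒count>0 (∈-allFin j) j∈supp)}}
    (double-count inside outside
      (λ x x-in → nbrCount-outside-of-inside (not-injective x-in)) (λ y → nbrCount-inside-of-outside))

  |C|s≡|Hᶜ|r : count inC V * s ≡ count outside V * r
  |C|s≡|Hᶜ|r = double-count inC outside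
    (λ x x∈C → nbrCount-outside-of-inside (C-inside x∈C))
    (λ y y-out → nbrCount-C-of-¬C (outside⇒¬inC y-out))

  |C|s̄≡|D|r : count inC V * s̄ ≡ count D V * r
  |C|s̄≡|D|r = double-count inC D (λ x → nbrCount-D-of-C) (λ y y∈D → nbrCount-C-of-¬C (D⇒¬inC y∈D))

  s+s̄≡3r : s + s̄ ≡ 3 * r
  s+s̄≡3r = begin
    s + s̄                          ≡⟨ count-partition (λ _ → true) supp (allFin n) ⟨
    count (λ _ → true) (allFin n) ≡⟨ count-true (allFin n) ⟩
    length (allFin n)             ≡⟨ length-tabulate (λ i → i) ⟩
    n                             ≡⟨ n≡3r ⟩
    3 * r                         ∎
    where open ≡-Reasoning

  s̄≡r×s≡2r : s̄ ≡ r × s ≡ 2 * r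
  s̄≡r×s≡2r = support-sizes (count inC V) (count D V) s s̄ r
    {{>-nonZero (∈⇒count>0 (∈-allVertices x₀) (c≡0⇒inC x₀∈C))}}
    (trans |C|s≡|Hᶜ|r (cong (_* r) (trans (sym |H|≡|Hᶜ|) |H|≡|C|+|D|))) |C|s̄≡|D|r s+s̄≡3r

  s̄≡r : s̄ ≡ r
  s̄≡r = proj₁ s̄≡r×s≡2r

  s≡2r : s ≡ 2 * r
  s≡2r = proj₂ s̄≡r×s≡2r

  inC-flipAt-¬supp : ∀ {w} i → outside w ≡ false → supp i ≡ false → inC (flipAt i w) ≡ not (inC w)
  inC-flipAt-¬supp {w} i w-in i∉supp with inC w in w∈C
  ... | true  = flipAt-C-¬C i w∈C
  ... | false = count-∧≡count⇒ off-supp-all-C (∈-allFin i) (cong not i∉supp)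
    where
    open ≡-Reasoning
    no-supp-nbr : suppCount w inC ≡ 0
    no-supp-nbr = count-∧-false supp
      (λ i i∈supp → outside⇒¬inC (trans (outside-flipAt-supp i∈supp) (cong not w-in))) (allFin n)
    off-supp-all-C : offSuppCount w inC ≡ s̄
    off-supp-all-C = begin
      offSuppCount w inC                    ≡⟨ cong (_+ offSuppCount w inC) no-supp-nbr ⟨
      suppCount w inC + offSuppCount w inC  ≡⟨ nbrCount-split w inC ⟨
      nbrCount w inC                        ≡⟨ nbrCount-C-of-¬C w∈C ⟩
      r                                     ≡⟨ s̄≡r ⟨
      s̄                                     ∎

  suppCount-C-of-outside : ∀ {z} → outside z ≡ true → suppCount z inC ≡ r
  suppCount-C-of-outside {z} z-out = begin
    suppCount z inC                       ≡⟨ +-identityʳ _ ⟨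
    suppCount z inC + 0                   ≡⟨ cong (suppCount z inC +_) no-off-supp-nbr ⟨
    suppCount z inC + offSuppCount z inC  ≡⟨ nbrCount-split z inC ⟨
    nbrCount z inC                        ≡⟨ nbrCount-C-of-¬C (outside⇒¬inC z-out) ⟩
    r                                     ∎
    where
    open ≡-Reasoning
    no-off-supp-nbr : offSuppCount z inC ≡ 0
    no-off-supp-nbr = count-∧-false (λ i → not (supp i))
      (λ i i∉supp → outside⇒¬inC (trans (outside-flipAt-¬supp (not-injective i∉supp)) z-out)) (allFin n)

  suppCount-¬C-of-outside : ∀ {z} → outside z ≡ true → suppCount z (λ y → not (inC y)) ≡ r
  suppCount-¬C-of-outside {z} z-out = +-cancelˡ-≡ r _ r (begin
    r + suppCount z (λ y → not (inC y))
      ≡⟨ cong (_+ suppCount z (λ y → not (inC y))) (suppCount-C-of-outside z-out) ⟨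
    suppCount z inC + suppCount z (λ y → not (inC y))
      ≡⟨ count-partition supp (λ i → inC (flipAt i z)) (allFin n) ⟨
    s     ≡⟨ s≡2r ⟩
    2 * r ≡⟨ cong (r +_) (+-identityʳ r) ⟩
    r + r ∎)
    where open ≡-Reasoning

  flipIf : Bool → Vertex n → Vertex n
  flipIf false x = x
  flipIf true  x = flipAt j x

  outside-flipIf : ∀ t x → outside (flipIf t x) ≡ outside x xor t
  outside-flipIf false x = sym (xor-identityʳ (outside x))
  outside-flipIf true  x = trans (outside-flipAt x j) (cong (outside x xor_) j∈supp)

  flipIf-flipAt : ∀ t i x → flipIf t (flipAt i x) ≡ flipAt i (flipIf t x)
  flipIf-flipAt false i x = refl
  flipIf-flipAt true  i x = flipAt-comm j i x

  toH toHᶜ : Vertex n → Vertex n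
  toH  x = flipIf (outside x) x
  toHᶜ x = flipIf (not (outside x)) x

  toH-inside : ∀ x → outside (toH x) ≡ false
  toH-inside x = trans (outside-flipIf (outside x) x) (xor-same (outside x))

  toHᶜ-outside : ∀ x → outside (toHᶜ x) ≡ true
  toHᶜ-outside x = trans (outside-flipIf (not (outside x)) x) (xor-inverseʳ (outside x))

  class : Colouring n 4
  class x = code (outside x) (inC (toH x))

  class-¬supp : ∀ x {i} → supp i ≡ false → class (flipAt i x) ≡ code (outside x) (not (inC (toH x)))
  class-¬supp x {i} i∉supp = begin
    code (outside (flipAt i x)) (inC (flipIf (outside (flipAt i x)) (flipAt i x)))
      ≡⟨ cong (λ t → code t (inC (flipIf t (flipAt i x)))) (outside-flipAt-¬supp i∉supp) ⟩
    code (outside x) (inC (flipIf (outside x) (flipAt i x)))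
      ≡⟨ cong (λ y → code (outside x) (inC y)) (flipIf-flipAt (outside x) i x) ⟩
    code (outside x) (inC (flipAt i (toH x)))
      ≡⟨ cong (code (outside x)) (inC-flipAt-¬supp i (toH-inside x) i∉supp) ⟩
    code (outside x) (not (inC (toH x))) ∎
    where open ≡-Reasoning

  class-supp : ∀ x {i} → supp i ≡ true →
    class (flipAt i x) ≡ code (not (outside x)) (inC (flipAt i (toHᶜ x)))
  class-supp x {i} i∈supp = begin
    code (outside (flipAt i x)) (inC (flipIf (outside (flipAt i x)) (flipAt i x)))
      ≡⟨ cong (λ t → code t (inC (flipIf t (flipAt i x)))) (outside-flipAt-supp i∈supp) ⟩
    code (not (outside x)) (inC (flipIf (not (outside x)) (flipAt i x)))
      ≡⟨ cong (λ y → code (not (outside x)) (inC y)) (flipIf-flipAt (not (outside x)) i x) ⟩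
    code (not (outside x)) (inC (flipAt i (toHᶜ x))) ∎
    where open ≡-Reasoning

  infix 7 _≐_
  _≐_ : Fin 4 → Fin 4 → Bool
  u ≐ k = does (u ≟ᶠ k)

  suppCount-class : ∀ x k →
    suppCount x (λ y → class y ≐ k)
      ≡ 𝟙 (code (not (outside x)) true ≐ k) * r + 𝟙 (code (not (outside x)) false ≐ k) * r
  suppCount-class x k = begin
    suppCount x (λ y → class y ≐ k)
      ≡⟨ count-∧-cong supp (λ i i∈supp → cong (_≐ k) (class-supp x i∈supp)) (allFin n) ⟩
    suppCount (toHᶜ x) (λ y → code h′ (inC y) ≐ k)
      ≡⟨ count-∧-image supp (λ i → inC (flipAt i (toHᶜ x))) (λ u → code h′ u ≐ k) (allFin n) ⟩
    𝟙 (code h′ true ≐ k) * suppCount (toHᶜ x) inC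
      + 𝟙 (code h′ false ≐ k) * suppCount (toHᶜ x) (λ y → not (inC y))
      ≡⟨ cong₂ _+_ (cong (𝟙 (code h′ true ≐ k) *_) (suppCount-C-of-outside (toHᶜ-outside x)))
                   (cong (𝟙 (code h′ false ≐ k) *_) (suppCount-¬C-of-outside (toHᶜ-outside x))) ⟩
    𝟙 (code h′ true ≐ k) * r + 𝟙 (code h′ false ≐ k) * r ∎
    where
    open ≡-Reasoning
    h′ : Bool
    h′ = not (outside x)

  offSuppCount-class : ∀ x k →
    offSuppCount x (λ y → class y ≐ k) ≡ 𝟙 (code (outside x) (not (inC (toH x))) ≐ k) * r
  offSuppCount-class x k = begin
    offSuppCount x (λ y → class y ≐ k)
      ≡⟨ count-∧-cong (λ i → not (supp i)) (λ i i∉supp → cong (_≐ k) (class-¬supp x (not-injective i∉supp)))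
                      (allFin n) ⟩
    count (λ i → not (supp i) ∧ N) (allFin n) ≡⟨ count-∧-const (λ i → not (supp i)) N (allFin n) ⟩
    𝟙 N * s̄                                   ≡⟨ cong (𝟙 N *_) s̄≡r ⟩
    𝟙 N * r                                   ∎
    where
    open ≡-Reasoning
    N : Bool
    N = code (outside x) (not (inC (toH x))) ≐ k

  nbrCount-class : ∀ x k → nbrCount x (λ y → class y ≐ k) ≡ M4 r (class x) k
  nbrCount-class x k = begin
    nbrCount x (λ y → class y ≐ k)
      ≡⟨ nbrCount-split x (λ y → class y ≐ k) ⟩
    suppCount x (λ y → class y ≐ k) + offSuppCount x (λ y → class y ≐ k)
      ≡⟨ cong₂ _+_ (suppCount-class x k) (offSuppCount-class x k) ⟩
    (𝟙 (code (not (outside x)) true ≐ k) * r + 𝟙 (code (not (outside x)) false ≐ k) * r)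
      + 𝟙 (code (outside x) (not (inC (toH x))) ≐ k) * r
      ≡⟨ M4-code r (outside x) (inC (toH x)) k ⟩
    M4 r (class x) k ∎
    where open ≡-Reasoning

  class-equitable : Equitable class (M4 r)
  class-equitable _ k x refl = trans (nbrsIn≡nbrCount class x k) (nbrCount-class x k)

  class≡0⇔C : ∀ x → (class x ≡ zero) ⇔ (c x ≡ zero)
  class≡0⇔C x with outside x in x-out
  ... | false = code-false-≟-zero (c x)
  ... | true  = mk⇔ (λ e → contradiction e (code-true≢zero _))
                    (λ x∈C → contradiction (trans (sym x-out) (C-inside (c≡0⇒inC x∈C))) λ ())

C-nonempty : ∀ {n r} (c : Colouring n 2) → Equitable c (M2 (suc r)) → ∃ λ x → c x ≡ zero
C-nonempty {n} c equitable with c (0ᵥ n) in c0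
... | zero     = 0ᵥ n , c0
... | suc zero = let i , flip∈C = count>0⇒∃ (allFin n) C-nbrs>0 in flipAt i (0ᵥ n) , ≟-zero⇒ flip∈C
  where
  C-nbrs>0 : 0 < nbrCount (0ᵥ n) (λ y → does (c y ≟ᶠ zero))
  C-nbrs>0 = subst (0 <_) (trans (sym (equitable _ zero (0ᵥ n) c0)) (nbrsIn≡nbrCount c (0ᵥ n) zero)) (s≤s z≤n)
  ≟-zero⇒ : ∀ {u : Fin 2} → does (u ≟ᶠ zero) ≡ true → u ≡ zero
  ≟-zero⇒ {zero} _ = refl

equitable-Q₀ : ∀ {k} (d : Colouring 0 k) (S : Fin k → Fin k → ℕ) → (∀ i j → S i j ≡ 0) → Equitable d S
equitable-Q₀ d S S≡0 i j [] _ = sym (S≡0 i j)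

M4-zero : ∀ i j → M4 0 i j ≡ 0
M4-zero i j with i ≟ᶠ j
... | yes _ = refl
... | no  _ = refl

corollary1 : (n r : ℕ) → n ≡ 3 * r → (c : Colouring n 2) → Equitable c (M2 r)
    → Semilinear (λ x → c x ≡ zero)
    → ∃ λ (d : Colouring n 4) → (∀ x → (d x ≡ zero) ⇔ (c x ≡ zero)) × Equitable d (M4 r)
corollary1 .0 zero refl c _ _ =
  (λ x → code false (does (c x ≟ᶠ zero))) , (λ x → code-false-≟-zero (c x)) , equitable-Q₀ _ (M4 0) M4-zero
corollary1 n (suc r) n≡3r c equitable semilinear =
  let x₀ , x₀∈C = C-nonempty c equitable
      a , b , (j , j∈supp) , C⊆H = semilinear⇒hyperplane (λ x → c x ≟ᶠ zero) semilinear x₀∈C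
      open SplitByHyperplane n≡3r c equitable a b C⊆H j j∈supp x₀ x₀∈C
  in class , class≡0⇔C , class-equitable
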